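{- Let $R_n$ be the total size of all chains in all plane trees with $n$ edges. Then $\sum_{n\ge0}R_nx^n=\frac{4B}{(3-B)^2}$, where $B=\frac{1}{\sqrt{1-4x}}$.
   Context: A plane tree is a rooted tree with linearly ordered children. A chain in a plane tree is a nonempty set of vertices all lying on a single path from the root to a leaf; its size is its number of vertices. $R_n=\sum |Q|$, summed over all pairs $(T,Q)$ with $T$ a plane tree with $n$ edges and $Q$ a chain of $T$. -}

module Defs where

open import Data.Nat using (ℕ; zero; suc; _+_; _∸_; _<_)
open import Data.Integer using (ℤ) renaming (_+_ to _+ℤ_; _*_ to _*ℤ_; -_ to -ℤ_; +_ to +ℤ_)
open import Data.List using (List; []; _∷_; _++_; length; map; upTo)
open import Data.Nat.ListAction using (sum)
open import Data.List.Relation.Unary.Linked using (Linked)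
open import Data.List.Relation.Unary.All using (All)
open import Data.Product using (Σ; ∃; _×_)
open import Relation.Binary.PropositionalEquality using (_≡_; _≢_)

data PTree : Set where
  node : List PTree → PTree

mutual
  edges : PTree → ℕ
  edges (node ts) = edgesL ts

  edgesL : List PTree → ℕ
  edgesL []       = 0
  edgesL (t ∷ ts) = suc (edges t + edgesL ts)

-- Vertices are addressed by the list of child indices from the root.
Addr : Set
Addr = List ℕ

data Child : ℕ → List PTree → PTree → Set where
  here  : ∀ {t ts} → Child zero (t ∷ ts) t
  there : ∀ {i u ts t} → Child i ts t → Child (suc i) (u ∷ ts) t

data At : PTree → Addr → PTree → Set where
  root  : ∀ {t} → At t [] t
  child : ∀ {ts i a c s} → Child i ts c → At c a s → At (node ts) (i ∷ a) s

Vertex : PTree → Addr → Set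
Vertex t a = ∃ λ s → At t a s

Leaf : PTree → Addr → Set
Leaf t a = At t a (node [])

Prefix : Addr → Addr → Set
Prefix a b = ∃ λ c → a ++ c ≡ b

StrictPrefix : Addr → Addr → Set
StrictPrefix a b = Prefix a b × a ≢ b

-- A chain of t, encoded canonically as the list of its vertices sorted
-- from the root downwards: nonempty, duplicate-free (strictly increasing
-- in the ancestor order), all vertices of t, and all lying on a single
-- path from the root to some leaf ℓ.
IsChain : PTree → List Addr → Set
IsChain t Q =
  (Q ≢ []) ×
  Linked StrictPrefix Q ×
  All (Vertex t) Q ×
  (∃ λ ℓ → Leaf t ℓ × All (λ a → Prefix a ℓ) Q)

-- R_n computed from an enumeration of plane trees with n edges and
-- an enumeration of the chains of each tree: sum of |Q| over all (T,Q).
Rseq : (ℕ → List PTree) → (PTree → List (List Addr)) → ℕ → ℕ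
Rseq trees chains n = sum (map (λ T → sum (map length (chains T))) (trees n))

Series : Set
Series = ℕ → ℤ

_⊛_ : Series → Series → Series
(f ⊛ g) n = Data.List.foldr _+ℤ_ (+ℤ 0) (map (λ k → f k *ℤ g (n ∸ k)) (upTo (suc n)))

oneS : Series
oneS zero    = +ℤ 1
oneS (suc _) = +ℤ 0

oneMinus4x : Series
oneMinus4x zero          = +ℤ 1
oneMinus4x (suc zero)    = -ℤ (+ℤ 4)
oneMinus4x (suc (suc _)) = +ℤ 0

threeMinus : Series → Series
threeMinus B zero    = +ℤ 3 +ℤ (-ℤ (B zero))
threeMinus B (suc n) = -ℤ (B (suc n))

-- Let C, A and S be the generating series, by number of edges, of plane trees counted
-- plainly, weighted by their number of chains and weighted by the total size of their
-- chains, and let P and Q be the corresponding series for forests. A chain of a tree is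
-- its root alone, or a chain of one child with or without the root on top; hence
-- A = C + 2P and S = C + P + 2Q. Splitting a forest into its first tree and the rest gives
-- C = 1 + xC², P = x(AC + CP) and Q = x(SC + CQ), and eliminating gives
-- S(3 - 2C)² = C(2 - C). The series D = 1 - 2xC satisfies D² = 1 - 4x, so
-- (BD - 1)(BD + 1) = 0; as BD + 1 has constant term 2 and ℤ[[x]] has no zero divisors,
-- BD = 1. Rewriting the relation for S in terms of D and clearing the units C and D
-- gives S(3 - B)² = 4B.

module Submission where

open import Defs
open import Algebra.Bundles using (CommutativeRing)
open import Data.Nat using (ℕ; zero; suc; _∸_)
open import Function using (id; _∘_)
open import Relation.Binary.PropositionalEquality using (_≡_; _≢_; _≗_)

module PowerSeries where
  open import Relation.Binary.PropositionalEquality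
  open import Algebra.Structures using (IsCommutativeRing)
  import Algebra.Properties.CommutativeSemigroup as CommSemigroupProperties
  import Algebra.Solver.Ring
  import Algebra.Solver.Ring.AlmostCommutativeRing as ACR
  open import Data.Integer using (ℤ; +_; 0ℤ; 1ℤ; _+_; _*_; -_)
  import Data.Integer.Properties as ℤ
  import Data.Integer as ℤ
  open import Data.List using (foldr; applyUpTo)
  open import Data.List.Properties using (map-applyUpTo)
  open import Data.Maybe using (Maybe; just; nothing)
  open import Data.Product using (_,_)
  open import Relation.Nullary using (yes; no; contradiction)
  open import Data.Nat using (_≤_; _<_; z≤n; s≤s)
  open import Data.Nat.Properties using (≤-refl; m≤n⇒m≤1+n)
  open import Data.Nat.Induction using (<-rec)
  open import Data.Sum using ([_,_]′)

  open CommSemigroupProperties ℤ.+-commutativeSemigroup using (interchange)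

  infixl 6 _⊕_

  κ : ℤ → Series
  κ c zero    = c
  κ c (suc _) = 0ℤ

  -- The unit is κ (+ 1) rather than oneS so that the ring solver's constant 1 is the unit.
  1ₛ : Series
  1ₛ = κ (+ 1)

  _⊕_ : Series → Series → Series
  (f ⊕ g) n = f n + g n

  ⊖_ : Series → Series
  (⊖ f) n = - f n

  0ₛ : Series
  0ₛ _ = 0ℤ

  cauchy : Series → Series → Series
  cauchy f g zero    = f 0 * g 0
  cauchy f g (suc n) = f 0 * g (suc n) + cauchy (f ∘ suc) g n

  ⊛≗cauchy : ∀ f g → f ⊛ g ≗ cauchy f g
  ⊛≗cauchy f g n = trans (cong (foldr _+_ 0ℤ) (map-applyUpTo id (λ k → f k * g (n ∸ k)) (suc n))) (unfold f g n)
    where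
    unfold : ∀ f g n → foldr _+_ 0ℤ (applyUpTo (λ k → f k * g (n ∸ k)) (suc n)) ≡ cauchy f g n
    unfold f g zero    = ℤ.+-identityʳ _
    unfold f g (suc n) = cong (_+_ (f 0 * g (suc n))) (unfold (f ∘ suc) g n)

  cauchy-cong : ∀ {f f′ g g′} → f ≗ f′ → g ≗ g′ → cauchy f g ≗ cauchy f′ g′
  cauchy-cong f≗ g≗ zero    = cong₂ _*_ (f≗ 0) (g≗ 0)
  cauchy-cong f≗ g≗ (suc n) = cong₂ _+_ (cong₂ _*_ (f≗ 0) (g≗ (suc n))) (cauchy-cong (f≗ ∘ suc) g≗ n)

  cauchy-distribʳ : ∀ f g h → cauchy (f ⊕ g) h ≗ cauchy f h ⊕ cauchy g h
  cauchy-distribʳ f g h zero    = ℤ.*-distribʳ-+ (h 0) (f 0) (g 0)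
  cauchy-distribʳ f g h (suc n) =
    trans (cong₂ _+_ (ℤ.*-distribʳ-+ (h (suc n)) (f 0) (g 0)) (cauchy-distribʳ (f ∘ suc) (g ∘ suc) h n))
          (interchange (f 0 * h (suc n)) (g 0 * h (suc n)) (cauchy (f ∘ suc) h n) (cauchy (g ∘ suc) h n))

  cauchy-zeroˡ : ∀ f g → f ≗ 0ₛ → cauchy f g ≗ 0ₛ
  cauchy-zeroˡ f g f≗0 zero    = trans (cong (_* g 0) (f≗0 0)) (ℤ.*-zeroˡ (g 0))
  cauchy-zeroˡ f g f≗0 (suc n) =
    cong₂ _+_ (trans (cong (_* g (suc n)) (f≗0 0)) (ℤ.*-zeroˡ (g (suc n)))) (cauchy-zeroˡ (f ∘ suc) g (f≗0 ∘ suc) n)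

  cauchy-κ : ∀ c g n → cauchy (κ c) g n ≡ c * g n
  cauchy-κ c g zero    = refl
  cauchy-κ c g (suc n) =
    trans (cong (_+_ (c * g (suc n))) (cauchy-zeroˡ (κ c ∘ suc) g (λ _ → refl) n)) (ℤ.+-identityʳ (c * g (suc n)))

  cauchy-unfoldʳ : ∀ f g n → cauchy f g (suc n) ≡ cauchy f (g ∘ suc) n + f (suc n) * g 0
  cauchy-unfoldʳ f g zero    = refl
  cauchy-unfoldʳ f g (suc n) =
    trans (cong (_+_ (f 0 * g (suc (suc n)))) (cauchy-unfoldʳ (f ∘ suc) g n))
          (sym (ℤ.+-assoc (f 0 * g (suc (suc n))) (cauchy (f ∘ suc) (g ∘ suc) n) (f (suc (suc n)) * g 0)))

  cauchy-comm : ∀ f g → cauchy f g ≗ cauchy g f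
  cauchy-comm f g zero    = ℤ.*-comm (f 0) (g 0)
  cauchy-comm f g (suc n) = begin
    f 0 * g (suc n) + cauchy (f ∘ suc) g n ≡⟨ cong₂ _+_ (ℤ.*-comm (f 0) (g (suc n))) (cauchy-comm (f ∘ suc) g n) ⟩
    g (suc n) * f 0 + cauchy g (f ∘ suc) n ≡⟨ ℤ.+-comm (g (suc n) * f 0) (cauchy g (f ∘ suc) n) ⟩
    cauchy g (f ∘ suc) n + g (suc n) * f 0 ≡⟨ sym (cauchy-unfoldʳ g f n) ⟩
    cauchy g f (suc n)                     ∎
    where open ≡-Reasoning

  cauchy-scaleˡ : ∀ c f g n → cauchy (λ k → c * f k) g n ≡ c * cauchy f g n
  cauchy-scaleˡ c f g zero    = ℤ.*-assoc c (f 0) (g 0)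
  cauchy-scaleˡ c f g (suc n) =
    trans (cong₂ _+_ (ℤ.*-assoc c (f 0) (g (suc n))) (cauchy-scaleˡ c (f ∘ suc) g n))
          (sym (ℤ.*-distribˡ-+ c (f 0 * g (suc n)) (cauchy (f ∘ suc) g n)))

  cauchy-assoc : ∀ f g h → cauchy (cauchy f g) h ≗ cauchy f (cauchy g h)
  cauchy-assoc f g h zero    = ℤ.*-assoc (f 0) (g 0) (h 0)
  cauchy-assoc f g h (suc n) = begin
    f 0 * g 0 * h (suc n) + cauchy (cauchy f g ∘ suc) h n
      ≡⟨ cong (_+_ (f 0 * g 0 * h (suc n))) (cauchy-distribʳ (λ k → f 0 * g (suc k)) (cauchy (f ∘ suc) g) h n) ⟩
    f 0 * g 0 * h (suc n) + (cauchy (λ k → f 0 * g (suc k)) h n + cauchy (cauchy (f ∘ suc) g) h n)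
      ≡⟨ cong₂ (λ u v → f 0 * g 0 * h (suc n) + (u + v)) (cauchy-scaleˡ (f 0) (g ∘ suc) h n) (cauchy-assoc (f ∘ suc) g h n) ⟩
    f 0 * g 0 * h (suc n) + (f 0 * cauchy (g ∘ suc) h n + cauchy (f ∘ suc) (cauchy g h) n)
      ≡⟨ sym (ℤ.+-assoc (f 0 * g 0 * h (suc n)) (f 0 * cauchy (g ∘ suc) h n) (cauchy (f ∘ suc) (cauchy g h) n)) ⟩
    f 0 * g 0 * h (suc n) + f 0 * cauchy (g ∘ suc) h n + cauchy (f ∘ suc) (cauchy g h) n
      ≡⟨ cong (_+ cauchy (f ∘ suc) (cauchy g h) n)
              (trans (cong (_+ f 0 * cauchy (g ∘ suc) h n) (ℤ.*-assoc (f 0) (g 0) (h (suc n))))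
                     (sym (ℤ.*-distribˡ-+ (f 0) (g 0 * h (suc n)) (cauchy (g ∘ suc) h n)))) ⟩
    f 0 * cauchy g h (suc n) + cauchy (f ∘ suc) (cauchy g h) n
      ∎
    where open ≡-Reasoning

  ⊛-cong : ∀ {f f′ g g′} → f ≗ f′ → g ≗ g′ → f ⊛ g ≗ f′ ⊛ g′
  ⊛-cong {f} {f′} {g} {g′} f≗ g≗ n =
    trans (⊛≗cauchy f g n) (trans (cauchy-cong f≗ g≗ n) (sym (⊛≗cauchy f′ g′ n)))

  ⊛-assoc : ∀ f g h → (f ⊛ g) ⊛ h ≗ f ⊛ (g ⊛ h)
  ⊛-assoc f g h n = begin
    ((f ⊛ g) ⊛ h) n           ≡⟨ ⊛≗cauchy (f ⊛ g) h n ⟩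
    cauchy (f ⊛ g) h n        ≡⟨ cauchy-cong (⊛≗cauchy f g) (λ _ → refl) n ⟩
    cauchy (cauchy f g) h n   ≡⟨ cauchy-assoc f g h n ⟩
    cauchy f (cauchy g h) n   ≡⟨ cauchy-cong (λ _ → refl) (λ k → sym (⊛≗cauchy g h k)) n ⟩
    cauchy f (g ⊛ h) n        ≡⟨ sym (⊛≗cauchy f (g ⊛ h) n) ⟩
    (f ⊛ (g ⊛ h)) n           ∎
    where open ≡-Reasoning

  ⊛-comm : ∀ f g → f ⊛ g ≗ g ⊛ f
  ⊛-comm f g n = trans (⊛≗cauchy f g n) (trans (cauchy-comm f g n) (sym (⊛≗cauchy g f n)))

  κ-⊛ : ∀ c f n → (κ c ⊛ f) n ≡ c * f n
  κ-⊛ c f n = trans (⊛≗cauchy (κ c) f n) (cauchy-κ c f n)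

  ⊛-identityˡ : ∀ f → 1ₛ ⊛ f ≗ f
  ⊛-identityˡ f n = trans (κ-⊛ 1ℤ f n) (ℤ.*-identityˡ (f n))

  ⊛-distribʳ : ∀ f g h → (g ⊕ h) ⊛ f ≗ g ⊛ f ⊕ h ⊛ f
  ⊛-distribʳ f g h n =
    trans (⊛≗cauchy (g ⊕ h) f n)
          (trans (cauchy-distribʳ g h f n) (sym (cong₂ _+_ (⊛≗cauchy g f n) (⊛≗cauchy h f n))))

  ⊛-distribˡ : ∀ f g h → f ⊛ (g ⊕ h) ≗ f ⊛ g ⊕ f ⊛ h
  ⊛-distribˡ f g h n =
    trans (⊛-comm f (g ⊕ h) n) (trans (⊛-distribʳ f g h n) (cong₂ _+_ (⊛-comm g f n) (⊛-comm h f n)))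

  series-isCommutativeRing : IsCommutativeRing _≗_ _⊕_ _⊛_ ⊖_ 0ₛ 1ₛ
  series-isCommutativeRing = record
    { isRing = record
      { +-isAbelianGroup = record
        { isGroup = record
          { isMonoid = record
            { isSemigroup = record
              { isMagma = record
                { isEquivalence = record { refl = λ _ → refl ; sym = λ p n → sym (p n) ; trans = λ p q n → trans (p n) (q n) }
                ; ∙-cong = λ p q n → cong₂ _+_ (p n) (q n) }
              ; assoc = λ f g h n → ℤ.+-assoc (f n) (g n) (h n) }
            ; identity = (λ f n → ℤ.+-identityˡ (f n)) , (λ f n → ℤ.+-identityʳ (f n)) }
          ; inverse = (λ f n → ℤ.+-inverseˡ (f n)) , (λ f n → ℤ.+-inverseʳ (f n))
          ; ⁻¹-cong = λ p n → cong -_ (p n) }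
        ; comm = λ f g n → ℤ.+-comm (f n) (g n) }
      ; *-cong = ⊛-cong
      ; *-assoc = ⊛-assoc
      ; *-identity = ⊛-identityˡ , (λ f n → trans (⊛-comm f 1ₛ n) (⊛-identityˡ f n))
      ; distrib = ⊛-distribˡ , ⊛-distribʳ }
    ; *-comm = ⊛-comm }

  seriesRing : CommutativeRing _ _
  seriesRing = record { isCommutativeRing = series-isCommutativeRing }

  κ-* : ∀ a b → κ (a * b) ≗ κ a ⊛ κ b
  κ-* a b zero    = sym (κ-⊛ a (κ b) 0)
  κ-* a b (suc n) = sym (trans (κ-⊛ a (κ b) (suc n)) (ℤ.*-zeroʳ a))

  κ-homomorphism : ACR._-Raw-AlmostCommutative⟶_ ℤ.+-*-rawRing (ACR.fromCommutativeRing seriesRing)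
  κ-homomorphism = record
    { ⟦_⟧    = κ
    ; +-homo = λ a b → λ { zero → refl ; (suc n) → refl }
    ; *-homo = κ-*
    ; -‿homo = λ a → λ { zero → refl ; (suc n) → refl }
    ; 0-homo = λ { zero → refl ; (suc n) → refl }
    ; 1-homo = λ { zero → refl ; (suc n) → refl }
    }

  κ-equal? : ∀ a b → Maybe (κ a ≗ κ b)
  κ-equal? a b with a ℤ.≟ b
  ... | yes refl = just (λ _ → refl)
  ... | no _     = nothing

  -- Written so that X ∘ suc is 1ₛ definitionally.
  X : Series
  X zero    = 0ℤ
  X (suc n) = 1ₛ n

  X-shift : ∀ f n → (X ⊛ f) (suc n) ≡ f n
  X-shift f n = begin
    (X ⊛ f) (suc n)                    ≡⟨ ⊛≗cauchy X f (suc n) ⟩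
    0ℤ * f (suc n) + cauchy 1ₛ f n     ≡⟨ cong (_+_ 0ℤ) (cauchy-κ 1ℤ f n) ⟩
    0ℤ + 1ℤ * f n                      ≡⟨ ℤ.+-identityˡ (1ℤ * f n) ⟩
    1ℤ * f n                           ≡⟨ ℤ.*-identityˡ (f n) ⟩
    f n                                ∎
    where open ≡-Reasoning

  cauchy-vanishes : ∀ h {g} n → (∀ {j} → j ≤ n → g j ≡ 0ℤ) → cauchy h g n ≡ 0ℤ
  cauchy-vanishes h zero    g≡0 = trans (cong (h 0 *_) (g≡0 z≤n)) (ℤ.*-zeroʳ (h 0))
  cauchy-vanishes h (suc n) g≡0 =
    cong₂ _+_ (trans (cong (h 0 *_) (g≡0 ≤-refl)) (ℤ.*-zeroʳ (h 0)))
              (cauchy-vanishes (h ∘ suc) n (λ j≤n → g≡0 (m≤n⇒m≤1+n j≤n)))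

  ⊛-cancelˡ : ∀ {f g} → f 0 ≢ 0ℤ → f ⊛ g ≗ 0ₛ → g ≗ 0ₛ
  ⊛-cancelˡ {f} {g} f₀≢0 fg≗0 = <-rec (λ n → g n ≡ 0ℤ) step
    where
    leading : ∀ n → (∀ {j} → j < n → g j ≡ 0ℤ) → f 0 * g n ≡ 0ℤ
    leading zero    _      = trans (sym (⊛≗cauchy f g 0)) (fg≗0 0)
    leading (suc n) g<n≡0 = begin
      f 0 * g (suc n)
        ≡⟨ sym (ℤ.+-identityʳ _) ⟩
      f 0 * g (suc n) + 0ℤ
        ≡⟨ cong (_+_ (f 0 * g (suc n))) (sym (cauchy-vanishes (f ∘ suc) n (g<n≡0 ∘ s≤s))) ⟩
      f 0 * g (suc n) + cauchy (f ∘ suc) g n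
        ≡⟨ sym (⊛≗cauchy f g (suc n)) ⟩
      (f ⊛ g) (suc n)
        ≡⟨ fg≗0 (suc n) ⟩
      0ℤ
        ∎
      where open ≡-Reasoning
    step : ∀ n → (∀ {j} → j < n → g j ≡ 0ℤ) → g n ≡ 0ℤ
    step n g<n≡0 = [ (λ f₀≡0 → contradiction f₀≡0 f₀≢0) , id ]′ (ℤ.i*j≡0⇒i≡0∨j≡0 (f 0) (leading n g<n≡0))

  module SeriesSolver = Algebra.Solver.Ring ℤ.+-*-rawRing (ACR.fromCommutativeRing seriesRing) κ-homomorphism κ-equal?

module SeriesIdentities where
  open import Data.Integer using (+_; 0ℤ; 1ℤ)
  import Data.Integer as ℤ
  import Relation.Binary.PropositionalEquality as ≡
  open PowerSeries
  open CommutativeRing seriesRing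
  open import Algebra.Properties.AbelianGroup +-abelianGroup using (x∙y⁻¹≈ε⇒x≈y; x≈y⇒x∙y⁻¹≈ε)
  open import Relation.Binary.Reasoning.Setoid setoid
  open SeriesSolver using (solve; _:+_; _:-_; _:*_; con; _:=_)

  -- Each identity f ≈ g below is proved by exhibiting f - g as a combination, built with
  -- ⊞, ⊟ and ⊠, of residuals of the hypotheses; the solver checks that polynomial identity.
  infixl 5 _⊞_ _⊟_
  infixr 6 _⊠_

  _⊞_ : ∀ {f g} → f ≈ 0# → g ≈ 0# → f + g ≈ 0#
  _⊞_ {f} {g} f≈0 g≈0 = trans (+-cong {f} {0#} {g} {0#} f≈0 g≈0) (+-identityˡ 0#)

  _⊟_ : ∀ {f g} → f ≈ 0# → g ≈ 0# → f - g ≈ 0#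
  _⊟_ {f} {g} f≈0 g≈0 = trans (+-cong {f} {0#} { - g} { - 0#} f≈0 (-‿cong g≈0)) (trans (+-identityˡ (- 0#)) (λ _ → ≡.refl))

  _⊠_ : ∀ a {f} → f ≈ 0# → a * f ≈ 0#
  _⊠_ a {f} f≈0 = trans (*-congˡ {a} {f} {0#} f≈0) (zeroʳ a)

  residual : ∀ {f g} → f ≈ g → f - g ≈ 0#
  residual = x≈y⇒x∙y⁻¹≈ε

  by-residual : ∀ {f g r} → f - g ≈ r → r ≈ 0# → f ≈ g
  by-residual {f} {g} f-g≈r r≈0 = x∙y⁻¹≈ε⇒x≈y f g (trans f-g≈r r≈0)

  unit⇒*-cancelˡ : ∀ u {v f g} → v * u ≈ 1# → u * f ≈ u * g → f ≈ g
  unit⇒*-cancelˡ u {v} {f} {g} vu≈1 uf≈ug = begin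
    f             ≈⟨ sym (*-identityˡ f) ⟩
    1# * f        ≈⟨ *-congʳ {f} {1#} {v * u} (sym vu≈1) ⟩
    v * u * f     ≈⟨ *-assoc v u f ⟩
    v * (u * f)   ≈⟨ *-congˡ {v} {u * f} {u * g} uf≈ug ⟩
    v * (u * g)   ≈⟨ sym (*-assoc v u g) ⟩
    v * u * g     ≈⟨ *-congʳ {g} {v * u} {1#} vu≈1 ⟩
    1# * g        ≈⟨ *-identityˡ g ⟩
    g             ∎

  module Catalan {C : Series} (catalan : C ≈ 1# + X * C * C) where

    C-inverse : (1# - X * C) * C ≈ 1#
    C-inverse = by-residual
      (solve 2 (λ x c → (con (+ 1) :- x :* c) :* c :- con (+ 1) := c :- (con (+ 1) :+ x :* c :* c)) (λ _ → ≡.refl) X C)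
      (residual catalan)

    C-cancelˡ : ∀ {f g} → C * f ≈ C * g → f ≈ g
    C-cancelˡ = unit⇒*-cancelˡ C {1# - X * C} C-inverse

    forest-solution : ∀ {T F} → F ≈ X * (T * C + C * F) → F ≈ X * T * C * C
    forest-solution {T} {F} F-eq = by-residual
      (solve 4 (λ x c t f → f :- x :* t :* c :* c
                         := c :* (f :- x :* (t :* c :+ c :* f)) :- f :* (c :- (con (+ 1) :+ x :* c :* c)))
             (λ _ → ≡.refl) X C T F)
      (C ⊠ residual F-eq ⊟ F ⊠ residual catalan)

    tree-solution : ∀ {V W F} → V ≈ W + κ (+ 2) * F → F ≈ X * V * C * C → V * (κ (+ 3) - κ (+ 2) * C) ≈ W
    tree-solution {V} {W} {F} V-eq F-eq = by-residual
      (solve 5 (λ x c v w f → v :* (con (+ 3) :- con (+ 2) :* c) :- w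
                           := (v :- (w :+ con (+ 2) :* f)) :+ con (+ 2) :* (f :- x :* v :* c :* c)
                              :- con (+ 2) :* v :* (c :- (con (+ 1) :+ x :* c :* c)))
             (λ _ → ≡.refl) X C V W F)
      (residual V-eq ⊞ κ (+ 2) ⊠ residual F-eq ⊟ κ (+ 2) * V ⊠ residual catalan)

    D : Series
    D = 1# - κ (+ 2) * X * C

    D-square : D * D ≈ 1# - κ (+ 4) * X
    D-square = by-residual
      (solve 2 (λ x c →
                 let d = con (+ 1) :- con (+ 2) :* x :* c in
                 d :* d :- (con (+ 1) :- con (+ 4) :* x) := con (+ 4) :* x :* ((con (+ 1) :+ x :* c :* c) :- c))
             (λ _ → ≡.refl) X C)
      (κ (+ 4) * X ⊠ residual (sym catalan))

    D-inverse : ∀ {B} → B 0 ≡ 1ℤ → B * B * (1# - κ (+ 4) * X) ≈ 1# → B * D ≈ 1#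
    D-inverse {B} B₀ B-eq = x∙y⁻¹≈ε⇒x≈y (B * D) 1# (⊛-cancelˡ {B * D + 1#} {B * D - 1#} constant-term≢0 product≈0)
      where
      product≈0 : (B * D + 1#) * (B * D - 1#) ≈ 0#
      product≈0 = trans
        (solve 3 (λ x c b →
                   let d = con (+ 1) :- con (+ 2) :* x :* c in
                   (b :* d :+ con (+ 1)) :* (b :* d :- con (+ 1))
                   := b :* b :* (d :* d :- (con (+ 1) :- con (+ 4) :* x)) :+ (b :* b :* (con (+ 1) :- con (+ 4) :* x) :- con (+ 1)))
               (λ _ → ≡.refl) X C B)
        (B * B ⊠ residual D-square ⊞ residual B-eq)
      constant-term≡2 : (B * D + 1#) 0 ≡ + 2
      constant-term≡2 = ≡.cong (λ b → b ℤ.* + 1 ℤ.+ 0ℤ ℤ.+ + 1) B₀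
      constant-term≢0 : (B * D + 1#) 0 ≢ 0ℤ
      constant-term≢0 eq with () ← ≡.trans (≡.sym constant-term≡2) eq

    total-in-C : ∀ {S A P} →
                 S * (κ (+ 3) - κ (+ 2) * C) ≈ C + P → A * (κ (+ 3) - κ (+ 2) * C) ≈ C → P ≈ X * A * C * C →
                 S * (κ (+ 3) - κ (+ 2) * C) * (κ (+ 3) - κ (+ 2) * C) ≈ C * (κ (+ 2) - C)
    total-in-C {S} {A} {P} S-eq A-eq P-eq = by-residual
      (solve 5 (λ x c s a p →
                 let e = con (+ 3) :- con (+ 2) :* c in
                 s :* e :* e :- c :* (con (+ 2) :- c)
                 := e :* (s :* e :- (c :+ p)) :+ e :* (p :- x :* a :* c :* c) :+ x :* c :* c :* (a :* e :- c)
                    :- c :* (c :- (con (+ 1) :+ x :* c :* c)))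
             (λ _ → ≡.refl) X C S A P)
      ((κ (+ 3) - κ (+ 2) * C) ⊠ residual S-eq ⊞ (κ (+ 3) - κ (+ 2) * C) ⊠ residual P-eq ⊞ X * C * C ⊠ residual A-eq
       ⊟ C ⊠ residual catalan)

    -- After multiplying by C², use C(3D - 1) = 2(3 - 2C) and CD = 2 - C.
    total-in-D : ∀ {S} → S * (κ (+ 3) - κ (+ 2) * C) * (κ (+ 3) - κ (+ 2) * C) ≈ C * (κ (+ 2) - C) →
                 S * (κ (+ 3) * D - 1#) * (κ (+ 3) * D - 1#) ≈ κ (+ 4) * D
    total-in-D {S} S-eq = C-cancelˡ (C-cancelˡ (by-residual
      (solve 3 (λ x c s →
                 let d = con (+ 1) :- con (+ 2) :* x :* c
                     e = con (+ 3) :- con (+ 2) :* c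
                     eC = c :- (con (+ 1) :+ x :* c :* c) in
                 c :* (c :* (s :* (con (+ 3) :* d :- con (+ 1)) :* (con (+ 3) :* d :- con (+ 1))))
                   :- c :* (c :* (con (+ 4) :* d))
                 := con (+ 6) :* s :* (c :* (con (+ 3) :* d :- con (+ 1)) :+ con (+ 2) :* e) :* eC
                    :+ con (+ 4) :* (s :* e :* e :- c :* (con (+ 2) :- c))
                    :- con (+ 8) :* c :* eC)
             (λ _ → ≡.refl) X C S)
      (κ (+ 6) * S * (C * (κ (+ 3) * D - 1#) + κ (+ 2) * (κ (+ 3) - κ (+ 2) * C)) ⊠ residual catalan
       ⊞ κ (+ 4) ⊠ residual S-eq ⊟ κ (+ 8) * C ⊠ residual catalan)))

    -- Multiplied by D², this is total-in-D once BD = 1 is used.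
    chainTotal-identity : ∀ {A S P Q B} →
                          A ≈ C + κ (+ 2) * P → S ≈ C + P + κ (+ 2) * Q →
                          P ≈ X * (A * C + C * P) → Q ≈ X * (S * C + C * Q) →
                          B 0 ≡ 1ℤ → B * B * (1# - κ (+ 4) * X) ≈ 1# →
                          S * (κ (+ 3) - B) * (κ (+ 3) - B) ≈ κ (+ 4) * B
    chainTotal-identity {A} {S} {P} {Q} {B} A-eq S-eq P-eq Q-eq B₀ B-eq = D-cancelˡ (D-cancelˡ (by-residual
      (solve 4 (λ x c s b →
                 let d = con (+ 1) :- con (+ 2) :* x :* c in
                 d :* (d :* (s :* (con (+ 3) :- b) :* (con (+ 3) :- b))) :- d :* (d :* (con (+ 4) :* b))
                 := s :* (con (+ 6) :* d :- d :* b :- con (+ 1)) :* (con (+ 1) :- b :* d)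
                    :+ (s :* (con (+ 3) :* d :- con (+ 1)) :* (con (+ 3) :* d :- con (+ 1)) :- con (+ 4) :* d)
                    :+ con (+ 4) :* d :* (con (+ 1) :- b :* d))
             (λ _ → ≡.refl) X C S B)
      (S * (κ (+ 6) * D - D * B - 1#) ⊠ residual (sym BD≈1) ⊞ residual S-in-D ⊞ κ (+ 4) * D ⊠ residual (sym BD≈1))))
      where
      P-sol : P ≈ X * A * C * C
      P-sol = forest-solution {A} {P} P-eq
      S-in-D : S * (κ (+ 3) * D - 1#) * (κ (+ 3) * D - 1#) ≈ κ (+ 4) * D
      S-in-D = total-in-D {S} (total-in-C {S} {A} {P} (tree-solution {S} {C + P} {Q} S-eq (forest-solution {S} {Q} Q-eq))
                                                      (tree-solution {A} {C} {P} A-eq P-sol) P-sol)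
      BD≈1 : B * D ≈ 1#
      BD≈1 = D-inverse {B} B₀ B-eq
      D-cancelˡ : ∀ {f g} → D * f ≈ D * g → f ≈ g
      D-cancelˡ = unit⇒*-cancelˡ D {B} BD≈1

module FiniteSums where
  open import Data.Nat using (_+_; _*_)
  import Data.Nat.Properties as ℕ
  open import Data.List using (List; []; _∷_; _++_; map; concatMap; cartesianProductWith)
  open import Data.Nat.ListAction using (sum)
  open import Data.Nat.ListAction.Properties using (sum-↭)
  open import Data.List.Membership.Propositional using (_∈_; find)
  open import Data.List.Membership.Propositional.Properties using (∈-concatMap⁻)
  open import Data.List.Membership.Propositional.Properties.WithK using (unique∧set⇒bag)
  open import Data.List.Relation.Binary.BagAndSetEquality using (∼bag⇒↭)
  import Data.List.Relation.Binary.Permutation.Propositional.Properties as Perm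
  open import Data.List.Relation.Unary.Unique.Propositional using (Unique)
  import Data.List.Relation.Unary.Unique.Propositional.Properties as Unique
  open import Data.List.Relation.Unary.AllPairs using ([]; _∷_)
  import Data.List.Relation.Unary.All as All
  open import Data.Product using (_×_; _,_)
  open import Function using (_⇔_)
  open import Relation.Binary.PropositionalEquality
  open import Relation.Nullary using (¬_)
  import Algebra.Properties.CommutativeSemigroup as CommSemigroupProperties
  open CommSemigroupProperties ℕ.+-commutativeSemigroup using (interchange)

  private
    variable
      A B C : Set

  ∑ : List A → (A → ℕ) → ℕ
  ∑ xs f = sum (map f xs)

  ∑-++ : ∀ (xs ys : List A) f → ∑ (xs ++ ys) f ≡ ∑ xs f + ∑ ys f
  ∑-++ []       ys f = refl
  ∑-++ (x ∷ xs) ys f = trans (cong (f x +_) (∑-++ xs ys f)) (sym (ℕ.+-assoc (f x) (∑ xs f) (∑ ys f)))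

  ∑-cong : ∀ (xs : List A) {f g} → (∀ x → f x ≡ g x) → ∑ xs f ≡ ∑ xs g
  ∑-cong []       f≗g = refl
  ∑-cong (x ∷ xs) f≗g = cong₂ _+_ (f≗g x) (∑-cong xs f≗g)

  ∑-+ : ∀ (xs : List A) f g → ∑ xs (λ x → f x + g x) ≡ ∑ xs f + ∑ xs g
  ∑-+ []       f g = refl
  ∑-+ (x ∷ xs) f g = trans (cong (f x + g x +_) (∑-+ xs f g)) (interchange (f x) (g x) (∑ xs f) (∑ xs g))

  ∑-*ˡ : ∀ (xs : List A) c f → ∑ xs (λ x → c * f x) ≡ c * ∑ xs f
  ∑-*ˡ []       c f = sym (ℕ.*-zeroʳ c)
  ∑-*ˡ (x ∷ xs) c f = trans (cong (c * f x +_) (∑-*ˡ xs c f)) (sym (ℕ.*-distribˡ-+ c (f x) (∑ xs f)))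

  ∑-*ʳ : ∀ (xs : List A) c f → ∑ xs (λ x → f x * c) ≡ ∑ xs f * c
  ∑-*ʳ xs c f = trans (∑-cong xs (λ x → ℕ.*-comm (f x) c)) (trans (∑-*ˡ xs c f) (ℕ.*-comm c (∑ xs f)))

  ∑-map : ∀ (g : A → B) xs f → ∑ (map g xs) f ≡ ∑ xs (f ∘ g)
  ∑-map g []       f = refl
  ∑-map g (x ∷ xs) f = cong (f (g x) +_) (∑-map g xs f)

  ∑-concatMap : ∀ (g : A → List B) xs f → ∑ (concatMap g xs) f ≡ ∑ xs (λ x → ∑ (g x) f)
  ∑-concatMap g []       f = refl
  ∑-concatMap g (x ∷ xs) f = trans (∑-++ (g x) (concatMap g xs) f) (cong (∑ (g x) f +_) (∑-concatMap g xs f))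

  ∑-unique : ∀ {xs ys : List A} → Unique xs → Unique ys → (∀ x → x ∈ xs ⇔ x ∈ ys) → ∀ f → ∑ xs f ≡ ∑ ys f
  ∑-unique xs! ys! xs⇔ys f = sum-↭ (Perm.map⁺ f (∼bag⇒↭ (unique∧set⇒bag xs! ys! (λ {x} → xs⇔ys x))))

  ∑-cartesianProductWith : ∀ (_∙_ : A → B → C) xs ys f →
    ∑ (cartesianProductWith _∙_ xs ys) f ≡ ∑ xs (λ x → ∑ ys (λ y → f (x ∙ y)))
  ∑-cartesianProductWith _∙_ []       ys f = refl
  ∑-cartesianProductWith _∙_ (x ∷ xs) ys f =
    trans (∑-++ (map (x ∙_) ys) (cartesianProductWith _∙_ xs ys) f)
          (cong₂ _+_ (∑-map (x ∙_) ys f) (∑-cartesianProductWith _∙_ xs ys f))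

  ∑-const : ∀ (xs : List A) c → ∑ xs (λ _ → c) ≡ c * ∑ xs (λ _ → 1)
  ∑-const xs c = trans (∑-cong xs (λ _ → sym (ℕ.*-identityʳ c))) (∑-*ˡ xs c (λ _ → 1))

  ∑-cartesianProductWith-+ : ∀ (_∙_ : A → B → C) xs ys {f a b} → (∀ x y → f (x ∙ y) ≡ a x + b y) →
    ∑ (cartesianProductWith _∙_ xs ys) f ≡ ∑ xs a * ∑ ys (λ _ → 1) + ∑ xs (λ _ → 1) * ∑ ys b
  ∑-cartesianProductWith-+ _∙_ xs ys {f} {a} {b} f≡ = begin
    ∑ (cartesianProductWith _∙_ xs ys) f
      ≡⟨ ∑-cartesianProductWith _∙_ xs ys f ⟩
    ∑ xs (λ x → ∑ ys (λ y → f (x ∙ y)))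
      ≡⟨ ∑-cong xs (λ x → trans (∑-cong ys (f≡ x)) (∑-+ ys (λ _ → a x) b)) ⟩
    ∑ xs (λ x → ∑ ys (λ _ → a x) + ∑ ys b)
      ≡⟨ ∑-+ xs (λ x → ∑ ys (λ _ → a x)) (λ _ → ∑ ys b) ⟩
    ∑ xs (λ x → ∑ ys (λ _ → a x)) + ∑ xs (λ _ → ∑ ys b)
      ≡⟨ cong₂ _+_ (trans (∑-cong xs (λ x → ∑-const ys (a x))) (∑-*ʳ xs (∑ ys (λ _ → 1)) a))
                   (trans (∑-const xs (∑ ys b)) (ℕ.*-comm (∑ ys b) (∑ xs (λ _ → 1)))) ⟩
    ∑ xs a * ∑ ys (λ _ → 1) + ∑ xs (λ _ → 1) * ∑ ys b
      ∎
    where open ≡-Reasoning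

  Unique-concatMap : ∀ (g : A → List B) (key : B → A) → (∀ {x y} → y ∈ g x → key y ≡ x) →
                     (∀ x → Unique (g x)) → ∀ {xs} → Unique xs → Unique (concatMap g xs)
  Unique-concatMap g key key-correct g-unique {[]}     []            = []
  Unique-concatMap g key key-correct g-unique {x ∷ xs} (x∉xs ∷ xs!) =
    Unique.++⁺ (g-unique x) (Unique-concatMap g key key-correct g-unique xs!) disjoint
    where
    disjoint : ∀ {v} → ¬ (v ∈ g x × v ∈ concatMap g xs)
    disjoint (p , q) with find (∈-concatMap⁻ g {xs = xs} q)
    ... | y , y∈xs , r = All.lookup x∉xs y∈xs (trans (sym (key-correct p)) (key-correct r))

module PlaneTreeChains where
  open FiniteSums
  open import Data.Nat using (_+_; _*_)
  import Data.Nat.Properties as ℕ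
  open import Data.List using (List; []; _∷_; _++_; map; length)
  import Data.List.Properties as List
  open import Data.List.Membership.Propositional using (_∈_)
  open import Data.List.Membership.Propositional.Properties using (∈-map⁺; ∈-map⁻; ∈-++⁺ˡ; ∈-++⁺ʳ; ∈-++⁻)
  open import Data.List.Relation.Unary.All using (All; []; _∷_)
  import Data.List.Relation.Unary.All as All
  import Data.List.Relation.Unary.All.Properties as All
  open import Data.List.Relation.Unary.Any using (here; there)
  open import Data.List.Relation.Unary.Linked using (Linked; []; [-]; _∷_)
  import Data.List.Relation.Unary.Linked as Linked
  import Data.List.Relation.Unary.Linked.Properties as Linked
  open import Data.List.Relation.Unary.Unique.Propositional using (Unique)
  open import Data.List.Relation.Unary.AllPairs using ([]; _∷_)
  import Data.List.Relation.Unary.Unique.Propositional.Properties as Unique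
  open import Data.Product using (∃; _×_; _,_; proj₂; uncurry)
  open import Data.Product.Properties using (,-injective; ,-injectiveʳ)
  open import Data.Nat.Solver using (module +-*-Solver)
  open +-*-Solver using (solve; _:+_; _:*_; con; _:=_)
  open import Data.Sum using (inj₁; inj₂)
  open import Data.Empty using (⊥-elim)
  open import Function using (_⇔_; mk⇔; case_of_)
  import Function.Properties.Equivalence as ⇔
  open import Relation.Binary.PropositionalEquality
  open import Relation.Nullary using (¬_)

  mutual
    chainCount : PTree → ℕ
    chainCount (node ts) = 1 + 2 * chainCountᶠ ts

    chainCountᶠ : List PTree → ℕ
    chainCountᶠ []       = 0
    chainCountᶠ (t ∷ ts) = chainCount t + chainCountᶠ ts

  mutual
    chainTotal : PTree → ℕ
    chainTotal (node ts) = 1 + chainCountᶠ ts + 2 * chainTotalᶠ ts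

    chainTotalᶠ : List PTree → ℕ
    chainTotalᶠ []       = 0
    chainTotalᶠ (t ∷ ts) = chainTotal t + chainTotalᶠ ts

  data Chain : PTree → Addr → List Addr → Set where
    only-root      : ∀ {t} → Chain t [] []
    in-child       : ∀ {ts i c a Q} → Child i ts c → Chain c a Q → Chain (node ts) (i ∷ a) (map (i ∷_) Q)
    root-and-child : ∀ {ts i c a Q} → Child i ts c → Chain c a Q → Chain (node ts) [] ((i ∷ a) ∷ map (i ∷_) Q)

  below : ℕ × Addr × List Addr → Addr × List Addr
  below (i , a , Q) = i ∷ a , map (i ∷_) Q

  withRoot : ℕ × Addr × List Addr → Addr × List Addr
  withRoot (i , a , Q) = [] , (i ∷ a) ∷ map (i ∷_) Q

  firstChild : Addr × List Addr → ℕ × Addr × List Addr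
  firstChild x = 0 , x

  nextChild : ℕ × Addr × List Addr → ℕ × Addr × List Addr
  nextChild (i , x) = suc i , x

  -- The chain a ∷ Q is listed as the pair (a , Q), which makes below and withRoot injective.
  mutual
    chains⁺ : PTree → List (Addr × List Addr)
    chains⁺ (node ts) = ([] , []) ∷ (map below (childChains ts) ++ map withRoot (childChains ts))

    childChains : List PTree → List (ℕ × Addr × List Addr)
    childChains []       = []
    childChains (c ∷ cs) = map firstChild (chains⁺ c) ++ map nextChild (childChains cs)

  mutual
    ∈chains⁺⇒Chain : ∀ {t a Q} → (a , Q) ∈ chains⁺ t → Chain t a Q
    ∈chains⁺⇒Chain {node ts} (here refl) = only-root
    ∈chains⁺⇒Chain {node ts} (there p) with ∈-++⁻ (map below (childChains ts)) p
    ... | inj₁ q with ∈-map⁻ below q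
    ...   | _ , r , refl with ∈childChains⇒Chain r
    ...     | _ , ch , C = in-child ch C
    ∈chains⁺⇒Chain {node ts} (there p) | inj₂ q with ∈-map⁻ withRoot q
    ...   | _ , r , refl with ∈childChains⇒Chain r
    ...     | _ , ch , C = root-and-child ch C

    ∈childChains⇒Chain : ∀ {ts i a Q} → (i , a , Q) ∈ childChains ts → ∃ λ c → Child i ts c × Chain c a Q
    ∈childChains⇒Chain {c ∷ cs} p with ∈-++⁻ (map firstChild (chains⁺ c)) p
    ... | inj₁ q with ∈-map⁻ firstChild q
    ...   | _ , r , refl = c , here , ∈chains⁺⇒Chain r
    ∈childChains⇒Chain {c ∷ cs} p | inj₂ q with ∈-map⁻ nextChild q
    ...   | _ , r , refl with ∈childChains⇒Chain r
    ...     | c′ , ch , C = c′ , there ch , C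

  mutual
    Chain⇒∈chains⁺ : ∀ {t a Q} → Chain t a Q → (a , Q) ∈ chains⁺ t
    Chain⇒∈chains⁺ {node ts} only-root              = here refl
    Chain⇒∈chains⁺ {node ts} (in-child ch C)       = there (∈-++⁺ˡ (∈-map⁺ below (Chain⇒∈childChains ch C)))
    Chain⇒∈chains⁺ {node ts} (root-and-child ch C) =
      there (∈-++⁺ʳ (map below (childChains ts)) (∈-map⁺ withRoot (Chain⇒∈childChains ch C)))

    Chain⇒∈childChains : ∀ {ts i c a Q} → Child i ts c → Chain c a Q → (i , a , Q) ∈ childChains ts
    Chain⇒∈childChains {c ∷ cs} here       C = ∈-++⁺ˡ (∈-map⁺ firstChild (Chain⇒∈chains⁺ C))
    Chain⇒∈childChains {c ∷ cs} (there ch) C =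
      ∈-++⁺ʳ (map firstChild (chains⁺ c)) (∈-map⁺ nextChild (Chain⇒∈childChains ch C))

  below-injective : ∀ {x y} → below x ≡ below y → x ≡ y
  below-injective {i , a , Q} {j , b , R} eq with ,-injective eq
  ... | refl , Q≡R = cong (λ S → i , a , S) (List.map-injective List.∷-injectiveʳ Q≡R)

  withRoot-injective : ∀ {x y} → withRoot x ≡ withRoot y → x ≡ y
  withRoot-injective eq = below-injective (cong₂ _,_ (List.∷-injectiveˡ eq′) (List.∷-injectiveʳ eq′))
    where eq′ = ,-injectiveʳ eq

  mutual
    chains⁺-unique : ∀ t → Unique (chains⁺ t)
    chains⁺-unique (node ts) =
      All.tabulate root-distinct
      ∷ Unique.++⁺ (Unique.map⁺ below-injective (childChains-unique ts))
                   (Unique.map⁺ withRoot-injective (childChains-unique ts))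
                   below-withRoot-disjoint
      where
      root-distinct : ∀ {v} → v ∈ map below (childChains ts) ++ map withRoot (childChains ts) → ([] , []) ≢ v
      root-distinct p with ∈-++⁻ (map below (childChains ts)) p
      ... | inj₁ q with ∈-map⁻ below q
      ...   | _ , _ , refl = λ ()
      root-distinct p | inj₂ q with ∈-map⁻ withRoot q
      ...   | _ , _ , refl = λ ()
      below-withRoot-disjoint : ∀ {v} → ¬ (v ∈ map below (childChains ts) × v ∈ map withRoot (childChains ts))
      below-withRoot-disjoint (p , q) with ∈-map⁻ below p | ∈-map⁻ withRoot q
      ... | _ , _ , refl | _ , _ , ()

    childChains-unique : ∀ ts → Unique (childChains ts)
    childChains-unique []       = []
    childChains-unique (c ∷ cs) =
      Unique.++⁺ (Unique.map⁺ ,-injectiveʳ (chains⁺-unique c))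
                 (Unique.map⁺ (λ { {_ , _} {_ , _} refl → refl }) (childChains-unique cs))
                 first-rest-disjoint
      where
      first-rest-disjoint : ∀ {v} → ¬ (v ∈ map firstChild (chains⁺ c) × v ∈ map nextChild (childChains cs))
      first-rest-disjoint (p , q) with ∈-map⁻ firstChild p | ∈-map⁻ nextChild q
      ... | _ , _ , refl | _ , _ , ()

  size : Addr × List Addr → ℕ
  size (a , Q) = length (a ∷ Q)

  mutual
    chains⁺-count : ∀ t → ∑ (chains⁺ t) (λ _ → 1) ≡ chainCount t
    chains⁺-count (node ts) = cong suc (begin
      ∑ (map below cc ++ map withRoot cc) (λ _ → 1)
        ≡⟨ ∑-++ (map below cc) (map withRoot cc) (λ _ → 1) ⟩
      ∑ (map below cc) (λ _ → 1) + ∑ (map withRoot cc) (λ _ → 1)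
        ≡⟨ cong₂ _+_ (trans (∑-map below cc (λ _ → 1)) (childChains-count ts))
                     (trans (∑-map withRoot cc (λ _ → 1)) (childChains-count ts)) ⟩
      chainCountᶠ ts + chainCountᶠ ts
        ≡⟨ cong (chainCountᶠ ts +_) (sym (ℕ.+-identityʳ (chainCountᶠ ts))) ⟩
      2 * chainCountᶠ ts
        ∎)
      where
      open ≡-Reasoning
      cc = childChains ts

    childChains-count : ∀ ts → ∑ (childChains ts) (λ _ → 1) ≡ chainCountᶠ ts
    childChains-count []       = refl
    childChains-count (c ∷ cs) =
      trans (∑-++ (map firstChild (chains⁺ c)) (map nextChild (childChains cs)) (λ _ → 1))
            (cong₂ _+_ (trans (∑-map firstChild (chains⁺ c) (λ _ → 1)) (chains⁺-count c))
                       (trans (∑-map nextChild (childChains cs) (λ _ → 1)) (childChains-count cs)))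

  mutual
    chains⁺-total : ∀ t → ∑ (chains⁺ t) size ≡ chainTotal t
    chains⁺-total (node ts) = cong suc (begin
      ∑ (map below cc ++ map withRoot cc) size
        ≡⟨ ∑-++ (map below cc) (map withRoot cc) size ⟩
      ∑ (map below cc) size + ∑ (map withRoot cc) size
        ≡⟨ cong₂ _+_ (trans (∑-map below cc size) (∑-cong cc below-size))
                     (trans (∑-map withRoot cc size)
                            (trans (∑-cong cc (cong suc ∘ below-size)) (∑-+ cc (λ _ → 1) (size ∘ proj₂)))) ⟩
      ∑ cc (size ∘ proj₂) + (∑ cc (λ _ → 1) + ∑ cc (size ∘ proj₂))
        ≡⟨ cong₂ (λ T K → T + (K + T)) (childChains-total ts) (childChains-count ts) ⟩
      chainTotalᶠ ts + (chainCountᶠ ts + chainTotalᶠ ts)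
        ≡⟨ rearrange (chainCountᶠ ts) (chainTotalᶠ ts) ⟩
      chainCountᶠ ts + 2 * chainTotalᶠ ts
        ∎)
      where
      open ≡-Reasoning
      cc = childChains ts
      below-size : ∀ x → size (below x) ≡ size (proj₂ x)
      below-size (i , a , Q) = cong suc (List.length-map (i ∷_) Q)
      rearrange : ∀ k t → t + (k + t) ≡ k + 2 * t
      rearrange = solve 2 (λ k t → t :+ (k :+ t) := k :+ con 2 :* t) refl

    childChains-total : ∀ ts → ∑ (childChains ts) (size ∘ proj₂) ≡ chainTotalᶠ ts
    childChains-total []       = refl
    childChains-total (c ∷ cs) =
      trans (∑-++ (map firstChild (chains⁺ c)) (map nextChild (childChains cs)) (size ∘ proj₂))
            (cong₂ _+_ (trans (∑-map firstChild (chains⁺ c) (size ∘ proj₂)) (chains⁺-total c))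
                       (trans (∑-map nextChild (childChains cs) (size ∘ proj₂)) (childChains-total cs)))

  some-leaf : ∀ t → ∃ (Leaf t)
  some-leaf (node [])      = [] , root
  some-leaf (node (c ∷ _)) with some-leaf c
  ... | ℓ , leaf = 0 ∷ ℓ , child here leaf

  Prefix-∷ : ∀ i {a b} → Prefix a b → Prefix (i ∷ a) (i ∷ b)
  Prefix-∷ i (d , e) = d , cong (i ∷_) e

  StrictPrefix-∷ : ∀ i {a b} → StrictPrefix a b → StrictPrefix (i ∷ a) (i ∷ b)
  StrictPrefix-∷ i (a≤b , a≢b) = Prefix-∷ i a≤b , a≢b ∘ List.∷-injectiveʳ

  lift-vertices : ∀ {i ts c} → Child i ts c → ∀ {Q} → All (Vertex c) Q → All (Vertex (node ts)) (map (i ∷_) Q)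
  lift-vertices ch vertices = All.map⁺ (All.map (λ (s , at) → s , child ch at) vertices)

  Chain⇒IsChain : ∀ {t a Q} → Chain t a Q → IsChain t (a ∷ Q)
  Chain⇒IsChain {t} only-root with some-leaf t
  ... | ℓ , leaf = (λ ()) , [-] , (t , root) ∷ [] , ℓ , leaf , (ℓ , refl) ∷ []
  Chain⇒IsChain (in-child {i = i} ch C) with Chain⇒IsChain C
  ... | _ , linked , vertices , ℓ , leaf , prefixes =
    (λ ()) , Linked.map⁺ (Linked.map (StrictPrefix-∷ i) linked) , lift-vertices ch vertices ,
    i ∷ ℓ , child ch leaf , All.map⁺ (All.map (Prefix-∷ i) prefixes)
  Chain⇒IsChain {node ts} (root-and-child {i = i} ch C) with Chain⇒IsChain C
  ... | _ , linked , vertices , ℓ , leaf , prefixes =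
    (λ ()) , ((_ , refl) , (λ ())) ∷ Linked.map⁺ (Linked.map (StrictPrefix-∷ i) linked) ,
    (node ts , root) ∷ lift-vertices ch vertices ,
    i ∷ ℓ , child ch leaf , (i ∷ ℓ , refl) ∷ All.map⁺ (All.map (Prefix-∷ i) prefixes)

  peel-index : ∀ {i ℓ a Q} → Linked StrictPrefix ((i ∷ a) ∷ Q) → All (λ b → Prefix b (i ∷ ℓ)) ((i ∷ a) ∷ Q) →
         ∃ λ Q′ → Q ≡ map (i ∷_) Q′ × Linked StrictPrefix (a ∷ Q′) × All (λ b → Prefix b ℓ) (a ∷ Q′)
  peel-index {Q = []} _ ((d , e) ∷ []) = [] , refl , [-] , (d , List.∷-injectiveʳ e) ∷ []
  peel-index {i} {a = a} {Q = _ ∷ _} (((d , refl) , a≢b) ∷ linked) ((d′ , e) ∷ prefixes) with peel-index linked prefixes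
  ... | Q′ , refl , linked′ , prefixes′ =
    (a ++ d) ∷ Q′ , refl , ((d , refl) , a≢b ∘ cong (i ∷_)) ∷ linked′ , (d′ , List.∷-injectiveʳ e) ∷ prefixes′

  leaf-prefixes⇒Chain : ∀ ℓ {t a Q} → Leaf t ℓ →
                        Linked StrictPrefix (a ∷ Q) → All (λ b → Prefix b ℓ) (a ∷ Q) → Chain t a Q
  leaf-prefixes⇒Chain []      {a = []}    {Q = []}    _ _ _ = only-root
  leaf-prefixes⇒Chain []      {a = []}    {Q = b ∷ _} _ ((_ , []≢b) ∷ _) (_ ∷ (d , e) ∷ _) =
    ⊥-elim ([]≢b (sym (List.++-conicalˡ b d e)))
  leaf-prefixes⇒Chain []      {a = _ ∷ _} _ _ ((_ , ()) ∷ _)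
  leaf-prefixes⇒Chain (i ∷ ℓ) {a = []}    {Q = []}    _ _ _ = only-root
  leaf-prefixes⇒Chain (i ∷ ℓ) {a = []}    {Q = [] ∷ _} _ ((_ , []≢[]) ∷ _) _ = ⊥-elim ([]≢[] refl)
  leaf-prefixes⇒Chain (i ∷ ℓ) {a = []}    {Q = (j ∷ b) ∷ _} (child ch leaf) (_ ∷ linked) (_ ∷ (d , e) ∷ prefixes)
    with refl ← List.∷-injectiveˡ e
    with Q′ , refl , linked′ , prefixes′ ← peel-index linked ((d , e) ∷ prefixes)
    = root-and-child ch (leaf-prefixes⇒Chain ℓ leaf linked′ prefixes′)
  leaf-prefixes⇒Chain (i ∷ ℓ) {a = j ∷ a} (child ch leaf) linked ((d , e) ∷ prefixes)
    with refl ← List.∷-injectiveˡ e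
    with Q′ , refl , linked′ , prefixes′ ← peel-index linked ((d , e) ∷ prefixes)
    = in-child ch (leaf-prefixes⇒Chain ℓ leaf linked′ prefixes′)

  IsChain⇒Chain : ∀ {t a Q} → IsChain t (a ∷ Q) → Chain t a Q
  IsChain⇒Chain (_ , linked , _ , ℓ , leaf , prefixes) = leaf-prefixes⇒Chain ℓ leaf linked prefixes

  chainList : PTree → List (List Addr)
  chainList t = map (uncurry _∷_) (chains⁺ t)

  ∈chainList⇔IsChain : ∀ t Q → Q ∈ chainList t ⇔ IsChain t Q
  ∈chainList⇔IsChain t []      =
    mk⇔ (λ p → case ∈-map⁻ (uncurry _∷_) p of λ { (_ , _ , ()) }) (λ ([]≢[] , _) → ⊥-elim ([]≢[] refl))
  ∈chainList⇔IsChain t (a ∷ Q) = mk⇔ to (∈-map⁺ (uncurry _∷_) ∘ Chain⇒∈chains⁺ ∘ IsChain⇒Chain)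
    where
    to : a ∷ Q ∈ chainList t → IsChain t (a ∷ Q)
    to p with ∈-map⁻ (uncurry _∷_) p
    ... | _ , q , refl = Chain⇒IsChain (∈chains⁺⇒Chain q)

  chains-total : ∀ t {chains} → Unique chains → (∀ Q → Q ∈ chains ⇔ IsChain t Q) → ∑ chains length ≡ chainTotal t
  chains-total t {chains} chains-unique chains-complete = begin
    ∑ chains length               ≡⟨ ∑-unique chains-unique chainList-unique same-members length ⟩
    ∑ (chainList t) length        ≡⟨ ∑-map (uncurry _∷_) (chains⁺ t) length ⟩
    ∑ (chains⁺ t) size            ≡⟨ chains⁺-total t ⟩
    chainTotal t                  ∎
    where
    open ≡-Reasoning
    chainList-unique : Unique (chainList t)
    chainList-unique = Unique.map⁺ (λ { {_ , _} {_ , _} refl → refl }) (chains⁺-unique t)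
    same-members : ∀ Q → Q ∈ chains ⇔ Q ∈ chainList t
    same-members Q = ⇔.trans (chains-complete Q) (⇔.sym (∈chainList⇔IsChain t Q))

module GeneratingSeries where
  open FiniteSums
  open PlaneTreeChains using (chainCount; chainCountᶠ; chainTotal; chainTotalᶠ)
  open PowerSeries using (κ; 1ₛ; _⊕_; X; X-shift; ⊛-cong; ⊛-assoc; κ-⊛; seriesRing)
  open import Data.Nat using (_+_; _*_; _≤_; s≤s)
  import Data.Nat.Properties as ℕ
  open import Data.Integer as ℤ using (ℤ; +_; 0ℤ)
  import Data.Integer.Properties as ℤ
  open import Data.List using (List; []; _∷_; map; foldr; upTo; concatMap; cartesianProductWith)
  import Data.List.Properties as List
  open import Data.List.Membership.Propositional using (_∈_; find)
  open import Data.List.Membership.Propositional.Properties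
    using ( ∈-map⁺; ∈-map⁻; ∈-cartesianProductWith⁺; ∈-cartesianProductWith⁻
          ; ∈-concatMap⁺; ∈-concatMap⁻; ∈-upTo⁺; ∈-upTo⁻)
  open import Data.List.Relation.Unary.Any using (here)
  import Data.List.Relation.Unary.Any as Any
  open import Data.List.Relation.Unary.AllPairs using ([]; _∷_)
  open import Data.List.Relation.Unary.All using ([])
  open import Data.List.Relation.Unary.Unique.Propositional using (Unique)
  import Data.List.Relation.Unary.Unique.Propositional.Properties as Unique
  open import Data.Product using (_,_)
  open import Function using (_⇔_; mk⇔)
  open import Function.Bundles using (Equivalence)
  import Function.Properties.Equivalence as ⇔
  open import Relation.Binary.PropositionalEquality

  _⋆_ : (ℕ → ℕ) → (ℕ → ℕ) → ℕ → ℕ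
  (a ⋆ b) m = ∑ (upTo (suc m)) (λ k → a k * b (m ∸ k))

  ⋆-⊛ : ∀ a b m → + (a ⋆ b) m ≡ ((+_ ∘ a) ⊛ (+_ ∘ b)) m
  ⋆-⊛ a b m = cast (upTo (suc m))
    where
    cast : ∀ ks → + ∑ ks (λ k → a k * b (m ∸ k)) ≡ foldr ℤ._+_ 0ℤ (map (λ k → + a k ℤ.* + b (m ∸ k)) ks)
    cast []       = refl
    cast (k ∷ ks) = trans (ℤ.pos-+ (a k * b (m ∸ k)) (∑ ks (λ k → a k * b (m ∸ k))))
                          (cong₂ ℤ._+_ (ℤ.pos-* (a k) (b (m ∸ k))) (cast ks))

  module TreeSeries (trees : ℕ → List PTree) (trees-unique : ∀ n → Unique (trees n))
                    (trees-complete : ∀ n T → T ∈ trees n ⇔ edges T ≡ n) where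

    children : PTree → List PTree
    children (node ts) = ts

    forests : ℕ → List (List PTree)
    forests n = map children (trees n)

    forests-unique : ∀ n → Unique (forests n)
    forests-unique n = Unique.map⁺ (λ { {node _} {node _} refl → refl }) (trees-unique n)

    forests-complete : ∀ n ts → ts ∈ forests n ⇔ edgesL ts ≡ n
    forests-complete n ts = mk⇔ to (∈-map⁺ children ∘ Equivalence.from (trees-complete n (node ts)))
      where
      to : ts ∈ forests n → edgesL ts ≡ n
      to p with ∈-map⁻ children p
      ... | node _ , T∈ , refl = Equivalence.to (trees-complete n _) T∈

    forestsWithFirst : ℕ → ℕ → List (List PTree)
    forestsWithFirst m k = cartesianProductWith _∷_ (trees k) (forests (m ∸ k))

    -- The forests with m + 1 edges, grouped by the number of edges of the first tree.
    forests-split : ℕ → List (List PTree)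
    forests-split m = concatMap (forestsWithFirst m) (upTo (suc m))

    forests-split-unique : ∀ m → Unique (forests-split m)
    forests-split-unique m = Unique-concatMap (forestsWithFirst m) first-size first-size-correct
      (λ k → Unique.cartesianProductWith⁺ _∷_ List.∷-injective (trees-unique k) (forests-unique (m ∸ k)))
      (Unique.upTo⁺ (suc m))
      where
      first-size : List PTree → ℕ
      first-size []      = 0
      first-size (t ∷ _) = edges t
      first-size-correct : ∀ {k ts} → ts ∈ forestsWithFirst m k → first-size ts ≡ k
      first-size-correct {k} p with ∈-cartesianProductWith⁻ _∷_ (trees k) (forests (m ∸ k)) p
      ... | t , _ , t∈ , _ , refl = Equivalence.to (trees-complete k t) t∈

    forests-split-complete : ∀ m ts → ts ∈ forests-split m ⇔ edgesL ts ≡ suc m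
    forests-split-complete m ts = mk⇔ (to ts) (from ts)
      where
      to : ∀ ts → ts ∈ forests-split m → edgesL ts ≡ suc m
      to ts p with find (∈-concatMap⁻ (forestsWithFirst m) {xs = upTo (suc m)} p)
      ... | k , k∈ , q with ∈-cartesianProductWith⁻ _∷_ (trees k) (forests (m ∸ k)) q
      ... | t , ts′ , t∈ , ts′∈ , refl =
        cong suc (trans (cong₂ _+_ (Equivalence.to (trees-complete k t) t∈) (Equivalence.to (forests-complete (m ∸ k) ts′) ts′∈))
                        (ℕ.m+[n∸m]≡n (ℕ.≤-pred (∈-upTo⁻ k∈))))
      from : ∀ ts → edgesL ts ≡ suc m → ts ∈ forests-split m
      from (t ∷ ts′) e = ∈-concatMap⁺ (forestsWithFirst m) {xs = upTo (suc m)} (Any.map (λ { refl → t∷ts′∈ }) k∈)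
        where
        e′ : edges t + edgesL ts′ ≡ m
        e′ = ℕ.suc-injective e
        k∈ : edges t ∈ upTo (suc m)
        k∈ = ∈-upTo⁺ (s≤s (subst (edges t ≤_) e′ (ℕ.m≤m+n (edges t) (edgesL ts′))))
        t∷ts′∈ : t ∷ ts′ ∈ forestsWithFirst m (edges t)
        t∷ts′∈ = ∈-cartesianProductWith⁺ _∷_ (Equivalence.from (trees-complete (edges t) t) refl)
                   (Equivalence.from (forests-complete (m ∸ edges t) ts′)
                                     (trans (sym (ℕ.m+n∸m≡n (edges t) (edgesL ts′))) (cong (_∸ edges t) e′)))

    ∑-forests-suc : ∀ m g → ∑ (forests (suc m)) g ≡ ∑ (forests-split m) g
    ∑-forests-suc m = ∑-unique (forests-unique (suc m)) (forests-split-unique m)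
      (λ ts → ⇔.trans (forests-complete (suc m) ts) (⇔.sym (forests-split-complete m ts)))

    ∑-forests-zero : ∀ g → ∑ (forests 0) g ≡ g [] + 0
    ∑-forests-zero = ∑-unique (forests-unique 0) ([] ∷ []) (λ ts → ⇔.trans (forests-complete 0 ts) (only-empty ts))
      where
      only-empty : ∀ ts → edgesL ts ≡ 0 ⇔ ts ∈ [] ∷ []
      only-empty []      = mk⇔ (λ _ → here refl) (λ _ → refl)
      only-empty (_ ∷ _) = mk⇔ (λ ()) (λ { (here ()) })

    treeSum : (PTree → ℕ) → ℕ → ℕ
    treeSum f n = ∑ (trees n) f

    numberOfTrees : ℕ → ℕ
    numberOfTrees = treeSum (λ _ → 1)

    ∑-forests-split : ∀ m {g f h} → (∀ t ts → g (t ∷ ts) ≡ f t + h ts) →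
      ∑ (forests-split m) g ≡ (treeSum f ⋆ numberOfTrees) m + (numberOfTrees ⋆ treeSum (h ∘ children)) m
    ∑-forests-split m {g} {f} {h} split = begin
      ∑ (forests-split m) g
        ≡⟨ ∑-concatMap (forestsWithFirst m) (upTo (suc m)) g ⟩
      ∑ (upTo (suc m)) (λ k → ∑ (forestsWithFirst m k) g)
        ≡⟨ ∑-cong (upTo (suc m)) first-tree-of-size ⟩
      ∑ (upTo (suc m)) (λ k → treeSum f k * numberOfTrees (m ∸ k) + numberOfTrees k * treeSum (h ∘ children) (m ∸ k))
        ≡⟨ ∑-+ (upTo (suc m)) (λ k → treeSum f k * numberOfTrees (m ∸ k))
                              (λ k → numberOfTrees k * treeSum (h ∘ children) (m ∸ k)) ⟩
      (treeSum f ⋆ numberOfTrees) m + (numberOfTrees ⋆ treeSum (h ∘ children)) m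
        ∎
      where
      open ≡-Reasoning
      first-tree-of-size : ∀ k → ∑ (forestsWithFirst m k) g
                                 ≡ treeSum f k * numberOfTrees (m ∸ k) + numberOfTrees k * treeSum (h ∘ children) (m ∸ k)
      first-tree-of-size k =
        trans (∑-cartesianProductWith-+ _∷_ (trees k) (forests (m ∸ k)) split)
              (cong₂ (λ u v → treeSum f k * u + numberOfTrees k * v)
                     (∑-map children (trees (m ∸ k)) (λ _ → 1)) (∑-map children (trees (m ∸ k)) h))

    series : (PTree → ℕ) → Series
    series f n = + treeSum f n

    treeCount : Series
    treeCount = series (λ _ → 1)

    forestSeries : (List PTree → ℕ) → Series
    forestSeries g = series (g ∘ children)

    forest-recursion : ∀ {g f h} → (∀ t ts → g (t ∷ ts) ≡ f t + h ts) →
                       forestSeries g ≗ κ (+ g []) ⊕ X ⊛ (series f ⊛ treeCount ⊕ treeCount ⊛ forestSeries h)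
    forest-recursion {g} split zero = cong +_ (trans (sym (∑-map children (trees 0) g)) (∑-forests-zero g))
    forest-recursion {g} {f} {h} split (suc m) = begin
      + ∑ (trees (suc m)) (g ∘ children)
        ≡⟨ cong +_ (trans (sym (∑-map children (trees (suc m)) g)) (trans (∑-forests-suc m g) (∑-forests-split m split))) ⟩
      + ((treeSum f ⋆ numberOfTrees) m + (numberOfTrees ⋆ treeSum (h ∘ children)) m)
        ≡⟨ ℤ.pos-+ ((treeSum f ⋆ numberOfTrees) m) ((numberOfTrees ⋆ treeSum (h ∘ children)) m) ⟩
      + (treeSum f ⋆ numberOfTrees) m ℤ.+ + (numberOfTrees ⋆ treeSum (h ∘ children)) m
        ≡⟨ cong₂ ℤ._+_ (⋆-⊛ (treeSum f) numberOfTrees m) (⋆-⊛ numberOfTrees (treeSum (h ∘ children)) m) ⟩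
      (series f ⊛ treeCount ⊕ treeCount ⊛ forestSeries h) m
        ≡⟨ sym (X-shift (series f ⊛ treeCount ⊕ treeCount ⊛ forestSeries h) m) ⟩
      (X ⊛ (series f ⊛ treeCount ⊕ treeCount ⊛ forestSeries h)) (suc m)
        ≡⟨ sym (ℤ.+-identityˡ ((X ⊛ (series f ⊛ treeCount ⊕ treeCount ⊛ forestSeries h)) (suc m))) ⟩
      (κ (+ g []) ⊕ X ⊛ (series f ⊛ treeCount ⊕ treeCount ⊛ forestSeries h)) (suc m)
        ∎
      where open ≡-Reasoning

    series-cong : ∀ {f g} → (∀ T → f T ≡ g T) → series f ≗ series g
    series-cong f≡g n = cong +_ (∑-cong (trees n) f≡g)

    series-+ : ∀ f g → series (λ T → f T + g T) ≗ series f ⊕ series g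
    series-+ f g n = trans (cong +_ (∑-+ (trees n) f g)) (ℤ.pos-+ (∑ (trees n) f) (∑ (trees n) g))

    series-scale : ∀ c f → series (λ T → c * f T) ≗ κ (+ c) ⊛ series f
    series-scale c f n = trans (cong +_ (∑-*ˡ (trees n) c f)) (trans (ℤ.pos-* c (∑ (trees n) f)) (sym (κ-⊛ (+ c) (series f) n)))

    catalan : treeCount ≗ 1ₛ ⊕ (X ⊛ treeCount) ⊛ treeCount
    catalan n = begin
      treeCount n
        ≡⟨ forest-recursion {λ _ → 1} {λ _ → 1} {λ _ → 0} (λ _ _ → refl) n ⟩
      (1ₛ ⊕ X ⊛ (treeCount ⊛ treeCount ⊕ treeCount ⊛ forestSeries (λ _ → 0))) n
        ≡⟨ cong (ℤ._+_ (1ₛ n)) (⊛-cong {X} (λ _ → refl) without-empty-part n) ⟩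
      (1ₛ ⊕ X ⊛ (treeCount ⊛ treeCount)) n
        ≡⟨ cong (ℤ._+_ (1ₛ n)) (sym (⊛-assoc X treeCount treeCount n)) ⟩
      (1ₛ ⊕ (X ⊛ treeCount) ⊛ treeCount) n
        ∎
      where
      open ≡-Reasoning
      without-empty-part : treeCount ⊛ treeCount ⊕ treeCount ⊛ forestSeries (λ _ → 0) ≗ treeCount ⊛ treeCount
      without-empty-part k = trans (cong (ℤ._+_ ((treeCount ⊛ treeCount) k))
                                          (trans (⊛-cong {treeCount} (λ _ → refl) (λ j → cong +_ (∑-const (trees j) 0)) k)
                                                 (CommutativeRing.zeroʳ seriesRing treeCount k)))
                                   (ℤ.+-identityʳ ((treeCount ⊛ treeCount) k))

    forest-recursion₀ : ∀ {g f h} → g [] ≡ 0 → (∀ t ts → g (t ∷ ts) ≡ f t + h ts) →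
                        forestSeries g ≗ X ⊛ (series f ⊛ treeCount ⊕ treeCount ⊛ forestSeries h)
    forest-recursion₀ {g} {f} {h} g[]≡0 split n =
      trans (forest-recursion {g} {f} {h} split n)
            (trans (cong (λ c → κ (+ c) n ℤ.+ rest n) g[]≡0)
                   (trans (cong (ℤ._+ rest n) (κ-zero n)) (ℤ.+-identityˡ (rest n))))
      where
      rest : Series
      rest = X ⊛ (series f ⊛ treeCount ⊕ treeCount ⊛ forestSeries h)
      κ-zero : ∀ n → κ 0ℤ n ≡ 0ℤ
      κ-zero zero    = refl
      κ-zero (suc _) = refl

    chainCount-series : series chainCount ≗ treeCount ⊕ κ (+ 2) ⊛ forestSeries chainCountᶠ
    chainCount-series n = begin
      series chainCount n
        ≡⟨ series-cong {g = λ T → 1 + 2 * chainCountᶠ (children T)} (λ { (node _) → refl }) n ⟩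
      series (λ T → 1 + 2 * chainCountᶠ (children T)) n
        ≡⟨ series-+ (λ _ → 1) (λ T → 2 * chainCountᶠ (children T)) n ⟩
      treeCount n ℤ.+ series (λ T → 2 * chainCountᶠ (children T)) n
        ≡⟨ cong (ℤ._+_ (treeCount n)) (series-scale 2 (chainCountᶠ ∘ children) n) ⟩
      (treeCount ⊕ κ (+ 2) ⊛ forestSeries chainCountᶠ) n
        ∎
      where open ≡-Reasoning

    chainTotal-series : series chainTotal ≗ treeCount ⊕ forestSeries chainCountᶠ ⊕ κ (+ 2) ⊛ forestSeries chainTotalᶠ
    chainTotal-series n = begin
      series chainTotal n
        ≡⟨ series-cong {g = λ T → 1 + chainCountᶠ (children T) + 2 * chainTotalᶠ (children T)} (λ { (node _) → refl }) n ⟩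
      series (λ T → 1 + chainCountᶠ (children T) + 2 * chainTotalᶠ (children T)) n
        ≡⟨ series-+ (λ T → 1 + chainCountᶠ (children T)) (λ T → 2 * chainTotalᶠ (children T)) n ⟩
      series (λ T → 1 + chainCountᶠ (children T)) n ℤ.+ series (λ T → 2 * chainTotalᶠ (children T)) n
        ≡⟨ cong₂ ℤ._+_ (series-+ (λ _ → 1) (chainCountᶠ ∘ children) n) (series-scale 2 (chainTotalᶠ ∘ children) n) ⟩
      (treeCount ⊕ forestSeries chainCountᶠ ⊕ κ (+ 2) ⊛ forestSeries chainTotalᶠ) n
        ∎
      where open ≡-Reasoning

    chainCountᶠ-series : forestSeries chainCountᶠ ≗ X ⊛ (series chainCount ⊛ treeCount ⊕ treeCount ⊛ forestSeries chainCountᶠ)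
    chainCountᶠ-series = forest-recursion₀ {chainCountᶠ} {chainCount} {chainCountᶠ} refl (λ _ _ → refl)

    chainTotalᶠ-series : forestSeries chainTotalᶠ ≗ X ⊛ (series chainTotal ⊛ treeCount ⊕ treeCount ⊛ forestSeries chainTotalᶠ)
    chainTotalᶠ-series = forest-recursion₀ {chainTotalᶠ} {chainTotal} {chainTotalᶠ} refl (λ _ _ → refl)

open PowerSeries using (κ; 1ₛ; _⊕_; ⊖_; X; ⊛-cong; ⊛-assoc; κ-⊛)
open SeriesIdentities using (module Catalan)
open FiniteSums using (∑-cong)
open PlaneTreeChains using (chainCount; chainCountᶠ; chainTotal; chainTotalᶠ; chains-total)
open GeneratingSeries using (module TreeSeries)
open import Data.Integer as ℤ using (ℤ; _*_; +_)
import Data.Integer.Properties as ℤ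
open import Data.List using (List)
open import Data.List.Membership.Propositional using (_∈_)
open import Data.List.Relation.Unary.Unique.Propositional using (Unique)
open import Function.Bundles using (_⇔_)
open import Relation.Binary.PropositionalEquality using (refl; sym; trans; cong; module ≡-Reasoning)

oneS≗1ₛ : oneS ≗ 1ₛ
oneS≗1ₛ zero    = refl
oneS≗1ₛ (suc _) = refl

oneMinus4x≗ : oneMinus4x ≗ 1ₛ ⊕ ⊖ (κ (+ 4) ⊛ X)
oneMinus4x≗ n = sym (trans (cong (λ c → 1ₛ n ℤ.+ ℤ.- c) (κ-⊛ (+ 4) X n)) (by-cases n))
  where
  by-cases : ∀ n → 1ₛ n ℤ.+ ℤ.- (+ 4 * X n) ≡ oneMinus4x n
  by-cases 0             = refl
  by-cases 1             = refl
  by-cases (suc (suc _)) = refl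

threeMinus≗ : ∀ B → threeMinus B ≗ κ (+ 3) ⊕ ⊖ B
threeMinus≗ B zero    = refl
threeMinus≗ B (suc n) = sym (ℤ.+-identityˡ (ℤ.- B (suc n)))

theorem6p3 :
  (trees : ℕ → List PTree) →
  (∀ n → Unique (trees n)) →
  (∀ n T → (T ∈ trees n) ⇔ (edges T ≡ n)) →
  (chains : PTree → List (List Addr)) →
  (∀ T → Unique (chains T)) →
  (∀ T Q → (Q ∈ chains T) ⇔ IsChain T Q) →
  (B : Series) →
  B 0 ≡ + 1 →
  (∀ n → ((B ⊛ B) ⊛ oneMinus4x) n ≡ oneS n) →
  ∀ n → ((λ m → + Rseq trees chains m) ⊛ (threeMinus B ⊛ threeMinus B)) n ≡ + 4 * B n
theorem6p3 trees trees-unique trees-complete chains chains-unique chains-complete B B₀ B-eq n = begin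
  (R ⊛ (threeMinus B ⊛ threeMinus B)) n
    ≡⟨ ⊛-cong R≗S (⊛-cong (threeMinus≗ B) (threeMinus≗ B)) n ⟩
  (S ⊛ ((κ (+ 3) ⊕ ⊖ B) ⊛ (κ (+ 3) ⊕ ⊖ B))) n
    ≡⟨ sym (⊛-assoc S (κ (+ 3) ⊕ ⊖ B) (κ (+ 3) ⊕ ⊖ B) n) ⟩
  ((S ⊛ (κ (+ 3) ⊕ ⊖ B)) ⊛ (κ (+ 3) ⊕ ⊖ B)) n
    ≡⟨ chainTotal-identity {A} {S} {P} {Q} {B} chainCount-series chainTotal-series
                                                chainCountᶠ-series chainTotalᶠ-series B₀ B-equation n ⟩
  (κ (+ 4) ⊛ B) n
    ≡⟨ κ-⊛ (+ 4) B n ⟩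
  + 4 * B n
    ∎
  where
  open ≡-Reasoning
  open TreeSeries trees trees-unique trees-complete
  open Catalan catalan using (chainTotal-identity)
  R S A P Q : Series
  R m = + Rseq trees chains m
  S = series chainTotal
  A = series chainCount
  P = forestSeries chainCountᶠ
  Q = forestSeries chainTotalᶠ
  R≗S : R ≗ S
  R≗S m = cong +_ (∑-cong (trees m) (λ T → chains-total T (chains-unique T) (chains-complete T)))
  B-equation : (B ⊛ B) ⊛ (1ₛ ⊕ ⊖ (κ (+ 4) ⊛ X)) ≗ 1ₛ
  B-equation k = trans (⊛-cong {B ⊛ B} (λ _ → refl) (λ j → sym (oneMinus4x≗ j)) k) (trans (B-eq k) (oneS≗1ₛ k))
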